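{- If the $\mathsf{ATR}$ judgment $\Gamma;f\colon\gamma\vdash e\colon\gamma$ is derivable, or the judgment $\Gamma;\_\vdash(\mathsf{crec}\,k\,(\lambda_r f.e))\colon\gamma$ is derivable, then $\mathrm{uses}(f,e)\le 1$.
   Context: Labels: strings over $\{\Box,\diamond\}$ of the form $(\Box\diamond)^n$ or $\diamond(\Box\diamond)^n$, $n\ge0$; $\varepsilon$ is the empty label; $\ell\le\ell'$ iff $\ell$ is a suffix of $\ell'$ (a linear order $\varepsilon<\diamond<\Box\diamond<\diamond\Box\diamond<\cdots$); $\mathrm{depth}(\ell)$ = number of $\Box$'s; $\Box_d=(\Box\diamond)^d$, $\diamond_d=\diamond(\Box\diamond)^d$. Base types $\mathrm N_\ell$; $\mathrm N_{\Box_d}$ is oracular, $\mathrm N_{\diamond_d}$ computational; $\mathrm N_\ell<:\mathrm N_{\ell'}$ iff $\ell\le\ell'$. $\mathsf{ATR}$ types: simple types of level $\le2$ over these base types; $(\sigma_1,\dots,\sigma_k)\to\tau$ means $\sigma_1\to\cdots\to\sigma_k\to\tau$; subtyping extended by ($\sigma_1<:\sigma_0$, $\tau_0<:\tau_1$) $\Rightarrow\sigma_0\to\tau_0<:\sigma_1\to\tau_1$. $\mathrm{tail}(\mathrm N_\ell)=\mathrm N_\ell$, $\mathrm{tail}(\sigma\to\tau)=\mathrm{tail}(\tau)$, $\mathrm{depth}(\sigma)=\mathrm{depth}(\mathrm{tail}(\sigma))$. A type $(\sigma_1,\dots,\sigma_k)\to\mathrm N_\ell$ is flat if some $\mathrm{tail}(\sigma_i)=\mathrm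 N_\ell$. Shift relation $\propto$: $\mathrm N_{\Box_d}\propto\mathrm N_{\Box_{d'}}$ and $\mathrm N_{\diamond_d}\propto\mathrm N_{\diamond_{d'}}$ for $d\le d'$; $(\sigma_1,\dots,\sigma_k)\to\mathrm N_{\ell_0}\propto(\sigma'_1,\dots,\sigma'_k)\to\mathrm N_{\ell'_0}$ iff (i) $\mathrm N_{\ell_0}\propto\mathrm N_{\ell'_0}$ and $\sigma_i\propto\sigma'_i$ for all $i$, (ii) $\mathrm{tail}(\sigma_i)=\mathrm N_{\ell_0}$ implies $\mathrm{tail}(\sigma'_i)=\mathrm N_{\ell'_0}$, (iii) $\mathrm{depth}(\ell'_0)-\mathrm{depth}(\ell_0)\ge D((\vec\sigma)\to\mathrm N_{\ell_0},\vec\sigma')$. Here ($\max\emptyset=0$): if all $\sigma_i$ are base, $D=\max\{\mathrm{depth}(\sigma'_i)-\mathrm{depth}(\sigma_i):\sigma_i<:\mathrm N_{\ell_0}\}$; if all are level 1, $D((\vec\sigma)\to\mathrm N_\ell,\vec\sigma')=\max\{\mathrm{depth}(\sigma'_i)-\mathrm{depth}(\sigma_i)+D((\vec\sigma)\to\mathrm{undo}(\sigma_i,\mathrm N_\ell),\vec\sigma'):\mathrm{undo}(\sigma_i,\mathrm N_\ell)\text{ defined}\}$; in the mixed case $D$ is the sum of $D$ computed on the level-0 subsequences and $D$ computed on the level-1 subsequences. $\mathrm{undo}((\mathrm N_{\ell_1},\dots,\mathrm N_{\ell_k})\to\mathrm N_{\ell_0},\mathrm N_\ell)$ is undefined if that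 type is flat or $\ell_0>\ell$, and otherwise is $\mathrm N_{\ell'\ell''}$ where $\ell'=\max\{\ell_i:\ell_i<\ell_0\}$ and $\ell''$ is the suffix of $\ell$ following the leftmost occurrence of $\ell_0$ in $\ell$. Raw expressions: $e::=k\mid(\mathsf c_{\mathbf0}e)\mid(\mathsf c_{\mathbf1}e)\mid(\mathsf de)\mid(\mathsf t_{\mathbf0}e)\mid(\mathsf t_{\mathbf1}e)\mid(\mathsf{down}\,e\,e)\mid x\mid(e\,e)\mid(\lambda x.e)\mid(\mathsf{If}\,e\,\mathsf{then}\,e\,\mathsf{else}\,e)\mid(\mathsf{crec}\,k\,(\lambda_r x.e))$, $k$ ranging over strings in $\{\mathbf0,\mathbf1\}^*$, variables of type level 0 or 1. Tail terms of $e$: $e$; $e'$ if $\lambda x.e'$ is a tail term; $e_1,e_2$ if $\mathsf{If}\,e_0\,\mathsf{then}\,e_1\,\mathsf{else}\,e_2$ is a tail term. $\mathrm{TailPos}(f,e)$: each occurrence of $f$ in $e$ is the head of a tail term of the form $(f\,e_1\cdots e_k)$. $\mathcal R$: the types $(\mathbf b_1,\dots,\mathbf b_k)\to\mathbf b$ with $\mathbf b_i,\mathbf b$ base, $\mathbf b_1$ oracular and every $\mathbf b_i<:\mathbf b_1$ oracular. Judgments $\Gamma;\Delta\vdash e\colon\gamma$ ($\Gamma$ intuitionistic, $\Delta$ affine; finite maps with disjoint domains; $\_$ = empty zone). Rules: $\Gamma;\Delta\vdash\epsilon\colon\mathrm N_\varepsilon$; $\Gamma;\Delta\vdash k\colon\mathrm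 N_\diamond$; $\Gamma,x\colon\sigma;\Delta\vdash x\colon\sigma$; $\Gamma;x\colon\gamma\vdash x\colon\gamma$; Shift (from $e\colon\sigma$, $\sigma\propto\tau$ infer $e\colon\tau$); Subsumption along $<:$; from $\Gamma;\Delta\vdash e\colon\mathrm N_{\diamond_d}$ infer $\Gamma;\Delta\vdash(\mathrm{op}\,e)\colon\mathrm N_{\diamond_d}$ for $\mathrm{op}\in\{\mathsf c_{\mathbf0},\mathsf c_{\mathbf1},\mathsf d,\mathsf t_{\mathbf0},\mathsf t_{\mathbf1}\}$; from $\Gamma;\Delta_0\vdash e_0\colon\mathrm N_{\ell_0}$ and $\Gamma;\Delta_1\vdash e_1\colon\mathrm N_{\ell_1}$ infer $\Gamma;\Delta_0,\Delta_1\vdash(\mathsf{down}\,e_0\,e_1)\colon\mathrm N_{\ell_1}$; from $\Gamma,x\colon\sigma;\Delta\vdash e\colon\tau$ infer $\Gamma;\Delta\vdash\lambda x.e\colon\sigma\to\tau$; from $\Gamma;\Delta\vdash e_0\colon\sigma\to\tau$ and $\Gamma;\_\vdash e_1\colon\sigma$ infer $\Gamma;\Delta\vdash(e_0\,e_1)\colon\tau$; from $\Gamma;\_\vdash e_0\colon\mathrm N_\ell$, $\Gamma;\Delta_1\vdash e_1\colon\mathrm N_{\ell'}$, $\Gamma;\Delta_2\vdash e_2\colon\mathrm N_{\ell'}$ infer $\Gamma;\Delta_1\cup\Delta_2\vdash(\mathsf{If}\,e_0\,\mathsf{then}\,e_1\,\mathsf{else}\,e_2)\colon\mathrm N_{\ell'}$;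 from $\Gamma;f\colon\gamma\vdash e\colon\gamma$ with $\gamma\in\mathcal R$ and $\mathrm{TailPos}(f,e)$ infer $\Gamma;\_\vdash(\mathsf{crec}\,k\,(\lambda_rf.e))\colon\gamma$ for any string constant $k$. $\mathrm{uses}(x,e)$: $0$ if $x$ is not free in $e$; otherwise $\mathrm{uses}(x,x)=1$; $\mathrm{uses}(x,(\mathrm{op}\,e_0))=\mathrm{uses}(x,\lambda y.e_0)=\mathrm{uses}(x,e_0)$; $\mathrm{uses}(x,(\mathsf{down}\,e_0\,e_1))=\mathrm{uses}(x,(e_0e_1))=\mathrm{uses}(x,e_0)+\mathrm{uses}(x,e_1)$; $\mathrm{uses}(x,\mathsf{If}\,e_0\,\mathsf{then}\,e_1\,\mathsf{else}\,e_2)=\mathrm{uses}(x,e_0)+\max(\mathrm{uses}(x,e_1),\mathrm{uses}(x,e_2))$; $\mathrm{uses}(x,\mathsf{crec}\,k\,(\lambda_rf.e_0))=\dagger$ (unbounded), where $a<\dagger$ and $a+\dagger=\dagger+a=\max(a,\dagger)=\dagger$ for $a\in\mathbb N$. -}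

module Defs where

open import Data.Nat as ℕ using (ℕ; zero; suc; _≤_)
open import Data.Integer as ℤ using (ℤ; +_; _-_; _⊔_)
open import Data.Bool using (Bool; true; false; if_then_else_; _∧_; _∨_; not)
open import Data.List using (List; []; _∷_; _++_; length; map; drop; zip; filter)
open import Data.List.Relation.Unary.All using (All)
open import Data.List.Relation.Unary.Any using (Any)
open import Data.List.Relation.Binary.Pointwise using (Pointwise)
open import Data.List.Relation.Binary.Suffix.Heterogeneous using (Suffix)
open import Data.List.Relation.Binary.Suffix.Heterogeneous.Properties using (suffix?)
open import Data.List.Relation.Binary.Prefix.Heterogeneous.Properties using (prefix?)
open import Data.Maybe using (Maybe; just; nothing)
open import Data.Product using (_×_; _,_; ∃; ∃-syntax; Σ)
open import Data.Sum using (_⊎_)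
open import Relation.Binary.PropositionalEquality using (_≡_; _≢_)
open import Relation.Nullary using (Dec; yes; no; ¬_; does)
open import Relation.Nullary.Decidable using (⌊_⌋)

-- Labels: strings over {□,◇}; the leftmost symbol is the head of the list.

data Sym : Set where
  □ ◇ : Sym

_≟S_ : (a b : Sym) → Dec (a ≡ b)
□ ≟S □ = yes _≡_.refl
□ ≟S ◇ = no (λ ())
◇ ≟S □ = no (λ ())
◇ ≟S ◇ = yes _≡_.refl

Str : Set
Str = List Sym

_≟Str_ : (a b : Str) → Dec (a ≡ b)
[] ≟Str [] = yes _≡_.refl
[] ≟Str (_ ∷ _) = no (λ ())
(_ ∷ _) ≟Str [] = no (λ ())
(x ∷ xs) ≟Str (y ∷ ys) with x ≟S y | xs ≟Str ys
... | yes _≡_.refl | yes _≡_.refl = yes _≡_.refl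
... | no p | _ = no (λ { _≡_.refl → p _≡_.refl })
... | yes _ | no q = no (λ { _≡_.refl → q _≡_.refl })

boxL : ℕ → Str
boxL zero = []
boxL (suc d) = □ ∷ ◇ ∷ boxL d

diaL : ℕ → Str
diaL d = ◇ ∷ boxL d

εL : Str
εL = []

IsLabel : Str → Set
IsLabel ℓ = ∃[ n ] (ℓ ≡ boxL n ⊎ ℓ ≡ diaL n)

_≤L_ : Str → Str → Set
ℓ ≤L ℓ' = Suffix _≡_ ℓ ℓ'

_<L_ : Str → Str → Set
ℓ <L ℓ' = ℓ ≤L ℓ' × ℓ ≢ ℓ'

_≤L?_ : (ℓ ℓ' : Str) → Dec (ℓ ≤L ℓ')
ℓ ≤L? ℓ' = suffix? _≟S_ ℓ ℓ'

leqb : Str → Str → Bool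
leqb ℓ ℓ' = ⌊ ℓ ≤L? ℓ' ⌋

ltb : Str → Str → Bool
ltb ℓ ℓ' = leqb ℓ ℓ' ∧ not ⌊ ℓ ≟Str ℓ' ⌋

eqb : Str → Str → Bool
eqb ℓ ℓ' = ⌊ ℓ ≟Str ℓ' ⌋

depthL : Str → ℕ
depthL [] = 0
depthL (□ ∷ ℓ) = suc (depthL ℓ)
depthL (◇ ∷ ℓ) = depthL ℓ

Oracular : Str → Set
Oracular ℓ = ∃[ d ] ℓ ≡ boxL d

Computational : Str → Set
Computational ℓ = ∃[ d ] ℓ ≡ diaL d

-- Types.  arr (σ₁ ∷ … ∷ σₖ ∷ []) ℓ  is  (σ₁,…,σₖ) → N_ℓ ;  arr [] ℓ is N_ℓ.

data Ty : Set where
  arr : List Ty → Str → Ty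

N : Str → Ty
N ℓ = arr [] ℓ

infixr 6 _⇒_
_⇒_ : Ty → Ty → Ty
σ ⇒ arr σs ℓ = arr (σ ∷ σs) ℓ

mutual
  level : Ty → ℕ
  level (arr σs ℓ) = levelArgs σs

  levelArgs : List Ty → ℕ
  levelArgs [] = 0
  levelArgs (σ ∷ σs) = suc (level σ) ℕ.⊔ levelArgs σs

mutual
  LabelsOK : Ty → Set
  LabelsOK (arr σs ℓ) = IsLabel ℓ × LabelsOKs σs

  LabelsOKs : List Ty → Set
  LabelsOKs [] = Data.Unit.⊤
    where import Data.Unit
  LabelsOKs (σ ∷ σs) = LabelsOK σ × LabelsOKs σs

ATRType : Ty → Set
ATRType σ = LabelsOK σ × level σ ≤ 2

tailL : Ty → Str
tailL (arr σs ℓ) = ℓ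

depth : Ty → ℕ
depth σ = depthL (tailL σ)

IsBase : Ty → Set
IsBase σ = level σ ≡ 0

data _<:_ : Ty → Ty → Set where
  base<: : ∀ {ℓ ℓ'} → ℓ ≤L ℓ' → N ℓ <: N ℓ'
  arr<: : ∀ {σ₀ σ₁ σs₀ σs₁ ℓ₀ ℓ₁} →
          σ₁ <: σ₀ → arr σs₀ ℓ₀ <: arr σs₁ ℓ₁ →
          arr (σ₀ ∷ σs₀) ℓ₀ <: arr (σ₁ ∷ σs₁) ℓ₁

Flat : Ty → Set
Flat (arr σs ℓ) = Any (λ σ → tailL σ ≡ ℓ) σs

-- maximum of a list of labels w.r.t. ≤ (all arguments are suffixes of one
-- string, hence comparable; the larger is the longer one); max ∅ = ε
maxLabel : List Str → Str
maxLabel [] = εL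
maxLabel (ℓ ∷ ℓs) with maxLabel ℓs
... | m = if leqb m ℓ then ℓ else m

-- suffix of ℓ following the leftmost occurrence of ℓ₀ in ℓ (if any)
afterLeftmost : Str → Str → Maybe Str
afterLeftmost ℓ₀ ℓ with prefix? _≟S_ ℓ₀ ℓ
afterLeftmost ℓ₀ ℓ | yes _ = just (drop (length ℓ₀) ℓ)
afterLeftmost ℓ₀ [] | no _ = nothing
afterLeftmost ℓ₀ (_ ∷ ℓ) | no _ = afterLeftmost ℓ₀ ℓ

anyb : {A : Set} → (A → Bool) → List A → Bool
anyb p [] = false
anyb p (x ∷ xs) = p x ∨ anyb p xs

undo : Ty → Str → Maybe Str
undo (arr σs ℓ₀) ℓ =
  if anyb (λ σ → eqb (tailL σ) ℓ₀) σs ∨ ltb ℓ ℓ₀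
  then nothing
  else undo′ (afterLeftmost ℓ₀ ℓ)
  where
  ℓ′ : Str
  ℓ′ = maxLabel (filter (λ ℓᵢ → ltb ℓᵢ ℓ₀ Data.Bool.≟ true) (map tailL σs))
    where import Data.Bool
  undo′ : Maybe Str → Maybe Str
  undo′ nothing = nothing
  undo′ (just ℓ″) = just (ℓ′ ++ ℓ″)

maxℤ : List ℤ → ℤ
maxℤ [] = + 0
maxℤ (x ∷ []) = x
maxℤ (x ∷ xs@(_ ∷ _)) = x ⊔ maxℤ xs

dd : Ty → Ty → ℤ
dd σ σ' = + depth σ' - + depth σ

D₀ : List (Ty × Ty) → Str → ℤ
D₀ ps ℓ₀ = maxℤ (go ps)
  where
  go : List (Ty × Ty) → List ℤ
  go [] = []
  go ((σ , σ') ∷ ps) = if leqb (tailL σ) ℓ₀ then dd σ σ' ∷ go ps else go ps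

D₁ : ℕ → List (Ty × Ty) → Str → ℤ
D₁ zero ps ℓ = + 0
D₁ (suc fuel) ps ℓ = maxℤ (go ps)
  where
  go : List (Ty × Ty) → List ℤ
  go [] = []
  go ((σ , σ') ∷ qs) with undo σ ℓ
  ... | nothing = go qs
  ... | just u = (dd σ σ' ℤ.+ D₁ fuel ps u) ∷ go qs

isLevel : ℕ → Ty → Bool
isLevel n σ = ⌊ level σ ℕ.≟ n ⌋

-- D((σ⃗) → N_ℓ₀, σ⃗') : sum of D on the level-0 and level-1 subsequences
-- (in the pure cases one of the two summands is over an empty list, hence 0)
D : List Ty → Str → List Ty → ℤ
D σs ℓ₀ σs' =
  D₀ (filter (λ p → isLevel 0 (Data.Product.proj₁ p) Data.Bool.≟ true) (zip σs σs')) ℓ₀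
  ℤ.+ D₁ (suc (length ℓ₀))
         (filter (λ p → isLevel 1 (Data.Product.proj₁ p) Data.Bool.≟ true) (zip σs σs')) ℓ₀
  where import Data.Bool
        import Data.Product

BaseShift : Str → Str → Set
BaseShift ℓ ℓ' = (∃[ d ] ∃[ d' ] (d ≤ d' × ℓ ≡ boxL d × ℓ' ≡ boxL d'))
               ⊎ (∃[ d ] ∃[ d' ] (d ≤ d' × ℓ ≡ diaL d × ℓ' ≡ diaL d'))

data _∝_ : Ty → Ty → Set where
  shift : ∀ {σs σs' ℓ₀ ℓ₀'} →
    BaseShift ℓ₀ ℓ₀' →
    Pointwise _∝_ σs σs' →
    Pointwise (λ σ σ' → tailL σ ≡ ℓ₀ → tailL σ' ≡ ℓ₀') σs σs' →
    D σs ℓ₀ σs' ℤ.≤ (+ depthL ℓ₀' - + depthL ℓ₀) →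
    arr σs ℓ₀ ∝ arr σs' ℓ₀'

Var : Set
Var = ℕ

data Bit : Set where
  𝟎 𝟏 : Bit

data Op : Set where
  c0 c1 dOp t0 t1 : Op

data Exp : Set where
  str  : List Bit → Exp
  op   : Op → Exp → Exp
  down : Exp → Exp → Exp
  var  : Var → Exp
  app  : Exp → Exp → Exp
  lam  : Var → Exp → Exp
  ite  : Exp → Exp → Exp → Exp
  crec : List Bit → Var → Exp → Exp     -- crec k (λ_r f. e)

free : Var → Exp → Bool
free x (str k) = false
free x (op o e) = free x e
free x (down e₀ e₁) = free x e₀ ∨ free x e₁
free x (var y) = ⌊ x ℕ.≟ y ⌋
free x (app e₀ e₁) = free x e₀ ∨ free x e₁
free x (lam y e) = not ⌊ x ℕ.≟ y ⌋ ∧ free x e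
free x (ite e₀ e₁ e₂) = free x e₀ ∨ free x e₁ ∨ free x e₂
free x (crec k y e) = not ⌊ x ℕ.≟ y ⌋ ∧ free x e

NotFree : Var → Exp → Set
NotFree x e = free x e ≡ false

spine : Exp → List Exp → Exp
spine h [] = h
spine h (e ∷ es) = spine (app h e) es

data TailPos (f : Var) : Exp → Set where
  tp-none  : ∀ {e} → NotFree f e → TailPos f e
  tp-spine : ∀ es → All (NotFree f) es → TailPos f (spine (var f) es)
  tp-lam   : ∀ {x e} → TailPos f e → TailPos f (lam x e)
  tp-if    : ∀ {e₀ e₁ e₂} → NotFree f e₀ → TailPos f e₁ → TailPos f e₂ →
             TailPos f (ite e₀ e₁ e₂)

-- Contexts: finite maps Var ⇀ Ty, represented by association lists
-- (the leftmost binding of a variable wins, so (x , σ) ∷ Γ is Γ,x:σ).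

Ctx : Set
Ctx = List (Var × Ty)

look : Ctx → Var → Maybe Ty
look [] x = nothing
look ((y , σ) ∷ Γ) x = if ⌊ x ℕ.≟ y ⌋ then just σ else look Γ x

Disjoint : Ctx → Ctx → Set
Disjoint Γ Δ = ∀ x → look Γ x ≡ nothing ⊎ look Δ x ≡ nothing

DisjUnion : Ctx → Ctx → Ctx → Set
DisjUnion Δ₀ Δ₁ Δ = ∀ x →
    (look Δ₀ x ≡ nothing × look Δ x ≡ look Δ₁ x)
  ⊎ (look Δ₁ x ≡ nothing × look Δ x ≡ look Δ₀ x)

Union : Ctx → Ctx → Ctx → Set
Union Δ₁ Δ₂ Δ = ∀ x →
    (look Δ₁ x ≡ nothing × look Δ x ≡ look Δ₂ x)
  ⊎ (look Δ₂ x ≡ nothing × look Δ x ≡ look Δ₁ x)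
  ⊎ (look Δ₁ x ≡ look Δ₂ x × look Δ x ≡ look Δ₁ x)

Singleton : Var → Ty → Ctx → Set
Singleton x γ Δ = look Δ x ≡ just γ × (∀ y → y ≢ x → look Δ y ≡ nothing)

VarTypesOK : Ctx → Set
VarTypesOK Γ = ∀ x σ → look Γ x ≡ just σ → ATRType σ × level σ ≤ 1

record WF (Γ Δ : Ctx) (γ : Ty) : Set where
  field
    disj  : Disjoint Γ Δ
    okΓ   : VarTypesOK Γ
    okΔ   : VarTypesOK Δ
    okTy  : ATRType γ

InR : Ty → Set
InR (arr [] ℓ) = Data.Empty.⊥
  where import Data.Empty
InR (arr (b₁ ∷ bs) ℓ) =
  All IsBase (b₁ ∷ bs) × Oracular (tailL b₁) ×
  All (λ b → b <: b₁ → Oracular (tailL b)) (b₁ ∷ bs)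

infix 4 _⨾_⊢_∶_
data _⨾_⊢_∶_ : Ctx → Ctx → Exp → Ty → Set where
  t-eps   : ∀ {Γ Δ} → WF Γ Δ (N εL) → Γ ⨾ Δ ⊢ str [] ∶ N εL
  t-str   : ∀ {Γ Δ} k → WF Γ Δ (N (◇ ∷ [])) → Γ ⨾ Δ ⊢ str k ∶ N (◇ ∷ [])
  t-var   : ∀ {Γ Δ x σ} → WF Γ Δ σ → look Γ x ≡ just σ → Γ ⨾ Δ ⊢ var x ∶ σ
  t-avar  : ∀ {Γ Δ x γ} → WF Γ Δ γ → Singleton x γ Δ → Γ ⨾ Δ ⊢ var x ∶ γ
  t-shift : ∀ {Γ Δ e σ τ} → WF Γ Δ τ → Γ ⨾ Δ ⊢ e ∶ σ → σ ∝ τ → Γ ⨾ Δ ⊢ e ∶ τ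
  t-sub   : ∀ {Γ Δ e σ τ} → WF Γ Δ τ → Γ ⨾ Δ ⊢ e ∶ σ → σ <: τ → Γ ⨾ Δ ⊢ e ∶ τ
  t-op    : ∀ {Γ Δ e d} o → WF Γ Δ (N (diaL d)) →
            Γ ⨾ Δ ⊢ e ∶ N (diaL d) → Γ ⨾ Δ ⊢ op o e ∶ N (diaL d)
  t-down  : ∀ {Γ Δ Δ₀ Δ₁ e₀ e₁ ℓ₀ ℓ₁} → WF Γ Δ (N ℓ₁) → DisjUnion Δ₀ Δ₁ Δ →
            Γ ⨾ Δ₀ ⊢ e₀ ∶ N ℓ₀ → Γ ⨾ Δ₁ ⊢ e₁ ∶ N ℓ₁ →
            Γ ⨾ Δ ⊢ down e₀ e₁ ∶ N ℓ₁
  t-lam   : ∀ {Γ Δ x e σ τ} → WF Γ Δ (σ ⇒ τ) →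
            ((x , σ) ∷ Γ) ⨾ Δ ⊢ e ∶ τ → Γ ⨾ Δ ⊢ lam x e ∶ σ ⇒ τ
  t-app   : ∀ {Γ Δ e₀ e₁ σ τ} → WF Γ Δ τ →
            Γ ⨾ Δ ⊢ e₀ ∶ σ ⇒ τ → Γ ⨾ [] ⊢ e₁ ∶ σ → Γ ⨾ Δ ⊢ app e₀ e₁ ∶ τ
  t-if    : ∀ {Γ Δ Δ₁ Δ₂ e₀ e₁ e₂ ℓ ℓ'} → WF Γ Δ (N ℓ') → Union Δ₁ Δ₂ Δ →
            Γ ⨾ [] ⊢ e₀ ∶ N ℓ → Γ ⨾ Δ₁ ⊢ e₁ ∶ N ℓ' → Γ ⨾ Δ₂ ⊢ e₂ ∶ N ℓ' →
            Γ ⨾ Δ ⊢ ite e₀ e₁ e₂ ∶ N ℓ'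
  t-crec  : ∀ {Γ f e γ} k → WF Γ [] γ → InR γ → TailPos f e →
            Γ ⨾ ((f , γ) ∷ []) ⊢ e ∶ γ → Γ ⨾ [] ⊢ crec k f e ∶ γ

data ℕ† : Set where
  fin : ℕ → ℕ†
  †   : ℕ†

_+†_ : ℕ† → ℕ† → ℕ† 
fin a +† fin b = fin (a ℕ.+ b)
_ +† _ = †

max† : ℕ† → ℕ† → ℕ†
max† (fin a) (fin b) = fin (a ℕ.⊔ b)
max† _ _ = †

infix 4 _≤†_
data _≤†_ : ℕ† → ℕ† → Set where
  fin≤ : ∀ {a b} → a ≤ b → fin a ≤† fin b
  to†  : ∀ {a} → a ≤† †

mutual
  uses : Var → Exp → ℕ†
  uses x e = if free x e then usesF x e else fin 0

  usesF : Var → Exp → ℕ†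
  usesF x (str k) = fin 0
  usesF x (op o e) = uses x e
  usesF x (down e₀ e₁) = uses x e₀ +† uses x e₁
  usesF x (var y) = fin 1
  usesF x (app e₀ e₁) = uses x e₀ +† uses x e₁
  usesF x (lam y e) = uses x e
  usesF x (ite e₀ e₁ e₂) = uses x e₀ +† max† (uses x e₁) (uses x e₂)
  usesF x (crec k y e) = †

-- The affine zone is never duplicated: `down` splits it disjointly, the
-- argument of an application and the guard of an If are typed in the empty
-- zone, and the two branches of an If share it, which `uses` matches with a
-- max.  A variable bound in neither zone does not occur free, so induction
-- on the derivation bounds by 1 the uses of any variable absent from the
-- intuitionistic zone.  The recursor name of a crec lives in the affine
-- zone, which is disjoint from the intuitionistic one.

module Submission where

open import Defs
open import Data.List using ([]; _∷_)
open import Data.Product using (_×_; _,_; ∃-syntax)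
open import Data.Sum using (_⊎_; inj₁; inj₂)
open import Data.Bool using (true; false; _∨_)
open import Data.Maybe using (just; nothing)
open import Data.Nat as ℕ using (z≤n)
open import Data.Nat.Properties using (+-identityʳ; ⊔-lub; ≤-refl)
open import Data.Empty using (⊥-elim)
open import Relation.Nullary using (yes; no)
open import Relation.Binary.PropositionalEquality
  using (_≡_; _≢_; refl; trans; sym; cong₂; subst)

⊢-WF : ∀ {Γ Δ e τ} → Γ ⨾ Δ ⊢ e ∶ τ → WF Γ Δ τ
⊢-WF (t-eps w) = w
⊢-WF (t-str k w) = w
⊢-WF (t-var w _) = w
⊢-WF (t-avar w _) = w
⊢-WF (t-shift w _ _) = w
⊢-WF (t-sub w _ _) = w
⊢-WF (t-op o w _) = w
⊢-WF (t-down w _ _ _) = w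
⊢-WF (t-lam w _) = w
⊢-WF (t-app w _ _) = w
⊢-WF (t-if w _ _ _ _) = w
⊢-WF (t-crec k w _ _ _) = w

look-here : ∀ {x σ} (Γ : Ctx) → look ((x , σ) ∷ Γ) x ≡ just σ
look-here {x} Γ with x ℕ.≟ x
... | yes _ = refl
... | no x≢x = ⊥-elim (x≢x refl)

look-there : ∀ {x y σ} (Γ : Ctx) → x ≢ y → look ((y , σ) ∷ Γ) x ≡ look Γ x
look-there {x} {y} Γ x≢y with x ℕ.≟ y
... | yes x≡y = ⊥-elim (x≢y x≡y)
... | no _ = refl

Disjoint-here : ∀ {Γ x γ} → Disjoint Γ ((x , γ) ∷ []) → look Γ x ≡ nothing
Disjoint-here {x = x} disj with disj x
... | inj₁ Γx≡nothing = Γx≡nothing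
... | inj₂ Δx≡nothing with trans (sym Δx≡nothing) (look-here [])
...   | ()

DisjUnion-unbound : ∀ {Δ₀ Δ₁ Δ x} → DisjUnion Δ₀ Δ₁ Δ → look Δ x ≡ nothing →
                    look Δ₀ x ≡ nothing × look Δ₁ x ≡ nothing
DisjUnion-unbound {x = x} u Δx with u x
... | inj₁ (Δ₀x , Δ≡Δ₁) = Δ₀x , trans (sym Δ≡Δ₁) Δx
... | inj₂ (Δ₁x , Δ≡Δ₀) = trans (sym Δ≡Δ₀) Δx , Δ₁x

Union-unbound : ∀ {Δ₁ Δ₂ Δ x} → Union Δ₁ Δ₂ Δ → look Δ x ≡ nothing →
                look Δ₁ x ≡ nothing × look Δ₂ x ≡ nothing
Union-unbound {x = x} u Δx with u x
... | inj₁ (Δ₁x , Δ≡Δ₂) = Δ₁x , trans (sym Δ≡Δ₂) Δx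
... | inj₂ (inj₁ (Δ₂x , Δ≡Δ₁)) = trans (sym Δ≡Δ₁) Δx , Δ₂x
... | inj₂ (inj₂ (Δ₁≡Δ₂ , Δ≡Δ₁)) =
  trans (sym Δ≡Δ₁) Δx , trans (sym Δ₁≡Δ₂) (trans (sym Δ≡Δ₁) Δx)

⊢-NotFree : ∀ {Γ Δ e τ} f → Γ ⨾ Δ ⊢ e ∶ τ →
            look Γ f ≡ nothing → look Δ f ≡ nothing → NotFree f e
⊢-NotFree f (t-eps w) Γf Δf = refl
⊢-NotFree f (t-str k w) Γf Δf = refl
⊢-NotFree f (t-var {x = x} w Γx) Γf Δf with f ℕ.≟ x
... | no _ = refl
... | yes refl with trans (sym Γf) Γx
...   | ()
⊢-NotFree f (t-avar {x = x} w (Δx , _)) Γf Δf with f ℕ.≟ x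
... | no _ = refl
... | yes refl with trans (sym Δf) Δx
...   | ()
⊢-NotFree f (t-shift w d _) Γf Δf = ⊢-NotFree f d Γf Δf
⊢-NotFree f (t-sub w d _) Γf Δf = ⊢-NotFree f d Γf Δf
⊢-NotFree f (t-op o w d) Γf Δf = ⊢-NotFree f d Γf Δf
⊢-NotFree f (t-down {Δ = Δ} {Δ₀} {Δ₁} w u d₀ d₁) Γf Δf =
  let Δ₀f , Δ₁f = DisjUnion-unbound {Δ₀} {Δ₁} {Δ} u Δf
  in cong₂ _∨_ (⊢-NotFree f d₀ Γf Δ₀f) (⊢-NotFree f d₁ Γf Δ₁f)
⊢-NotFree f (t-lam {Γ = Γ} {x = x} w d) Γf Δf with f ℕ.≟ x
... | yes _ = refl
... | no f≢x = ⊢-NotFree f d (trans (look-there Γ f≢x) Γf) Δf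
⊢-NotFree f (t-app w d₀ d₁) Γf Δf =
  cong₂ _∨_ (⊢-NotFree f d₀ Γf Δf) (⊢-NotFree f d₁ Γf refl)
⊢-NotFree f (t-if {Δ = Δ} {Δ₁} {Δ₂} w u d₀ d₁ d₂) Γf Δf =
  let Δ₁f , Δ₂f = Union-unbound {Δ₁} {Δ₂} {Δ} u Δf
  in cong₂ _∨_ (⊢-NotFree f d₀ Γf refl)
               (cong₂ _∨_ (⊢-NotFree f d₁ Γf Δ₁f) (⊢-NotFree f d₂ Γf Δ₂f))
⊢-NotFree f (t-crec {f = g} k w _ _ d) Γf Δf with f ℕ.≟ g
... | yes _ = refl
... | no f≢g = ⊢-NotFree f d Γf (look-there [] f≢g)

fin0≤† : ∀ {c} → fin 0 ≤† c
fin0≤† {fin _} = fin≤ z≤n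
fin0≤† {†} = to†

+†-≤†-zeroˡ : ∀ {a b c} → a ≡ fin 0 → b ≤† c → a +† b ≤† c
+†-≤†-zeroˡ refl (fin≤ b≤c) = fin≤ b≤c
+†-≤†-zeroˡ refl to† = to†

+†-≤†-zeroʳ : ∀ {a b c} → a ≤† c → b ≡ fin 0 → a +† b ≤† c
+†-≤†-zeroʳ {fin a} (fin≤ a≤c) refl rewrite +-identityʳ a = fin≤ a≤c
+†-≤†-zeroʳ to† refl = to†

max†-lub : ∀ {a b c} → a ≤† c → b ≤† c → max† a b ≤† c
max†-lub (fin≤ a≤c) (fin≤ b≤c) = fin≤ (⊔-lub a≤c b≤c)
max†-lub {c = †} _ _ = to†

uses-NotFree : ∀ x e → NotFree x e → uses x e ≡ fin 0
uses-NotFree x e x∉e with free x e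
uses-NotFree x e refl | false = refl

uses-≤† : ∀ x e {c} → usesF x e ≤† c → uses x e ≤† c
uses-≤† x e usesF≤c with free x e
... | true = usesF≤c
... | false = fin0≤†

uses-lam-≤† : ∀ x y e {c} → (x ≢ y → uses x e ≤† c) → uses x (lam y e) ≤† c
uses-lam-≤† x y e uses≤c with x ℕ.≟ y
... | yes _ = fin0≤†
... | no x≢y with free x e
...   | true = uses≤c x≢y
...   | false = fin0≤†

⊢-uses≤1 : ∀ {Γ Δ e τ} f → Γ ⨾ Δ ⊢ e ∶ τ → look Γ f ≡ nothing → uses f e ≤† fin 1
⊢-uses≤1 f (t-eps w) Γf = fin≤ z≤n
⊢-uses≤1 f (t-str k w) Γf = fin≤ z≤n
⊢-uses≤1 f (t-var w _) Γf = uses-≤† f (var _) (fin≤ ≤-refl)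
⊢-uses≤1 f (t-avar w _) Γf = uses-≤† f (var _) (fin≤ ≤-refl)
⊢-uses≤1 f (t-shift w d _) Γf = ⊢-uses≤1 f d Γf
⊢-uses≤1 f (t-sub w d _) Γf = ⊢-uses≤1 f d Γf
⊢-uses≤1 f (t-op {e = e} o w d) Γf = uses-≤† f (op o e) (⊢-uses≤1 f d Γf)
⊢-uses≤1 f (t-down {e₀ = e₀} {e₁ = e₁} w u d₀ d₁) Γf with u f
... | inj₁ (Δ₀f , _) = uses-≤† f (down e₀ e₁)
  (+†-≤†-zeroˡ (uses-NotFree f e₀ (⊢-NotFree f d₀ Γf Δ₀f)) (⊢-uses≤1 f d₁ Γf))
... | inj₂ (Δ₁f , _) = uses-≤† f (down e₀ e₁)
  (+†-≤†-zeroʳ (⊢-uses≤1 f d₀ Γf) (uses-NotFree f e₁ (⊢-NotFree f d₁ Γf Δ₁f)))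
⊢-uses≤1 f (t-lam {Γ = Γ} {x = x} {e = e} w d) Γf =
  uses-lam-≤† f x e (λ f≢x → ⊢-uses≤1 f d (trans (look-there Γ f≢x) Γf))
⊢-uses≤1 f (t-app {e₀ = e₀} {e₁ = e₁} w d₀ d₁) Γf = uses-≤† f (app e₀ e₁)
  (+†-≤†-zeroʳ (⊢-uses≤1 f d₀ Γf) (uses-NotFree f e₁ (⊢-NotFree f d₁ Γf refl)))
⊢-uses≤1 f (t-if {e₀ = e₀} {e₁ = e₁} {e₂ = e₂} w u d₀ d₁ d₂) Γf = uses-≤† f (ite e₀ e₁ e₂)
  (+†-≤†-zeroˡ (uses-NotFree f e₀ (⊢-NotFree f d₀ Γf refl))
               (max†-lub (⊢-uses≤1 f d₁ Γf) (⊢-uses≤1 f d₂ Γf)))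
⊢-uses≤1 f d@(t-crec {f = g} {e = e} k _ _ _ _) Γf =
  subst (_≤† fin 1) (sym (uses-NotFree f (crec k g e) (⊢-NotFree f d Γf refl))) fin0≤†

⊢-crec-body : ∀ {Γ Δ k f e τ} → Γ ⨾ Δ ⊢ crec k f e ∶ τ →
              ∃[ γ ] (Γ ⨾ ((f , γ) ∷ []) ⊢ e ∶ γ)
⊢-crec-body (t-shift w d _) = ⊢-crec-body d
⊢-crec-body (t-sub w d _) = ⊢-crec-body d
⊢-crec-body (t-crec {γ = γ} k w _ _ d) = γ , d

affine-uses≤1 : ∀ {Γ f γ e} → Γ ⨾ ((f , γ) ∷ []) ⊢ e ∶ γ → uses f e ≤† fin 1
affine-uses≤1 {Γ} {f} d = ⊢-uses≤1 f d (Disjoint-here {Γ} (WF.disj (⊢-WF d)))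

lemma5p6 : ∀ (Γ : Ctx) (f : Var) (γ : Ty) (e : Exp) →
    (Γ ⨾ ((f , γ) ∷ []) ⊢ e ∶ γ) ⊎ (∃[ k ] (Γ ⨾ [] ⊢ crec k f e ∶ γ)) →
    uses f e ≤† fin 1
lemma5p6 Γ f γ e (inj₁ d) = affine-uses≤1 d
lemma5p6 Γ f γ e (inj₂ (k , d)) = let _ , body = ⊢-crec-body d in affine-uses≤1 body
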